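{- The set $R_b(\infty)$ is a distributive lattice with $$s(p\vee q)_i = \min(s(p)_i,s(q)_i) \quad\text{and}\quad s(p\wedge q)_i = \max(s(p)_i,s(q)_i)$$ for all $p$ and $q$ in $R_b(\infty)$. Moreover, for all $n$ the functions $$\pi : s=(s_1,s_2,\dots,s_k) \longmapsto \pi(s)=(\infty,s_2,\dots,s_k)$$ and $$\tau : s=(s_1,s_2,\dots,s_k) \longmapsto \tau(s)=(\infty,s_1,s_2,\dots,s_k)$$ are lattice embeddings of $R_b(n)$ into $R_b(\infty)$.
   Context: Fix an integer $b>1$. A $b$-ary partition of a non-negative integer $n$ is a tuple $(p_0,p_1,\dots,p_{k-1})$ of non-negative integers with $p_{k-1}\neq 0$ and $n=\sum_i p_i b^i$. The evolution rule (firing $i$) is: $p \to q$ if $p_i \ge b$, $q_i = p_i - b$, $q_{i+1} = p_{i+1}+1$ (with $p_k=0$ if needed), and $q_j=p_j$ for all other $j$; $q$ is called a successor of $p$. $R_b(n)$ denotes the set of $b$-ary partitions of $n$ reachable from the one-part partition $(n)$ by iterating this rule, ordered by the reflexive and transitive closure of the successor relation; it is a distributive lattice containing all $b$-ary partitions of $n$, with $s(p\vee q)_i=\min(s(p)_i,s(q)_i)$ and $s(p\wedge q)_i=\max(s(p)_i,s(q)_i)$. $R_b(\infty)$ denotes the set of all tuples reachable from $(\infty)$ (first component infinite) by iterating the same rule, ordered by the reflexive and transitive closure of the successor relation. The shot vector $s(p)$ of an element $p$ (of $R_b(n)$, resp. $R_b(\infty)$) is defined by: $s(p)_i$ is the number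 of times one must fire $i$ to obtain $p$ from $(n)$ (resp. from $(\infty)$); it is independent of the firing sequence used. In $R_b(n)$, $p\le q$ iff $s(p)_i\ge s(q)_i$ for all $i$. -}

module Defs where

open import Data.Nat using (ℕ; zero; suc; _≤_; _∸_; _⊓_; _⊔_)
open import Data.List using (List; []; _∷_; drop)
open import Data.Product using (Σ; _×_; _,_; proj₁; proj₂)
open import Relation.Binary.PropositionalEquality using (_≡_)
open import Relation.Binary.Construct.Closure.ReflexiveTransitive using (Star; ε; _◅_)
open import Relation.Binary.Lattice.Structures using (IsLattice; IsDistributiveLattice)
open import Algebra.Core using (Op₂)
open import Data.Bool using (if_then_else_)
open import Data.Nat using (_≡ᵇ_)

-- A tuple (p_0, ..., p_{k-1}) is represented by the list p_0 ∷ ... ∷ p_{k-1} ∷ [].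

data Fire (b : ℕ) : ℕ → List ℕ → List ℕ → Set where
  fire-mid  : ∀ {x y ys} → b ≤ x → Fire b zero (x ∷ y ∷ ys) ((x ∸ b) ∷ suc y ∷ ys)
  fire-end  : ∀ {x} → b ≤ x → Fire b zero (x ∷ []) ((x ∸ b) ∷ 1 ∷ [])
  fire-tail : ∀ {i y ys zs} → Fire b i ys zs → Fire b (suc i) (y ∷ ys) (y ∷ zs)

-- An element (∞, p_1, ..., p_{k-1}) of R_b(∞) is represented by the list
-- p_1 ∷ ... ∷ p_{k-1} ∷ [] of its finite components; (∞) is [].
-- Firing 0 is always allowed (∞ ≥ b, ∞ - b = ∞); firing i+1 acts on the finite part.
data Fire∞ (b : ℕ) : ℕ → List ℕ → List ℕ → Set where
  fire0-nil  : Fire∞ b zero [] (1 ∷ [])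
  fire0-cons : ∀ {y ys} → Fire∞ b zero (y ∷ ys) (suc y ∷ ys)
  fire-pos   : ∀ {i p q} → Fire b i p q → Fire∞ b (suc i) p q

Successor : ℕ → List ℕ → List ℕ → Set
Successor b p q = Σ ℕ λ i → Fire b i p q

Successor∞ : ℕ → List ℕ → List ℕ → Set
Successor∞ b p q = Σ ℕ λ i → Fire∞ b i p q

shots : ∀ {F : ℕ → List ℕ → List ℕ → Set} {p q : List ℕ} →
        Star (λ x y → Σ ℕ λ j → F j x y) p q → ℕ → ℕ
shots ε i = zero
shots ((j , _) ◅ rest) i = if j ≡ᵇ i then suc (shots rest i) else shots rest i

-- the one-part partition (n); for n = 0 it is the empty partition (no nonzero part)
start : ℕ → List ℕ
start zero    = []
start (suc n) = suc n ∷ []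

Rb : ℕ → ℕ → Set
Rb b n = Σ (List ℕ) λ p → Star (Successor b) (start n) p

R∞ : ℕ → Set
R∞ b = Σ (List ℕ) λ p → Star (Successor∞ b) [] p

_≈ₙ_ : ∀ {b n} → Rb b n → Rb b n → Set
p ≈ₙ q = proj₁ p ≡ proj₁ q

_≈∞_ : ∀ {b} → R∞ b → R∞ b → Set
p ≈∞ q = proj₁ p ≡ proj₁ q

_≤ₙ_ : ∀ {b n} → Rb b n → Rb b n → Set
_≤ₙ_ {b} p q = Star (Successor b) (proj₁ q) (proj₁ p)

_≤∞_ : ∀ {b} → R∞ b → R∞ b → Set
_≤∞_ {b} p q = Star (Successor∞ b) (proj₁ q) (proj₁ p)

-- underlying maps on tuples:
-- π (p_0, p_1, ..., p_{k-1}) = (∞, p_1, ..., p_{k-1})    (finite part: drop p_0)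
-- τ (p_0, p_1, ..., p_{k-1}) = (∞, p_0, p_1, ..., p_{k-1}) (finite part: all of p)
πList : List ℕ → List ℕ
πList p = drop 1 p

τList : List ℕ → List ℕ
τList p = p

record IsLatticeEmbedding (b n : ℕ) (_∨∞_ _∧∞_ : Op₂ (R∞ b))
                          (g : List ℕ → List ℕ) (f : Rb b n → R∞ b) : Set₁ where
  field
    underlying : ∀ p → proj₁ (f p) ≡ g (proj₁ p)
    injective  : ∀ p q → f p ≈∞ f q → p ≈ₙ q
    hom        : (_∨ₙ_ _∧ₙ_ : Op₂ (Rb b n)) →
                 IsLattice (_≈ₙ_ {b} {n}) (_≤ₙ_ {b} {n}) _∨ₙ_ _∧ₙ_ →
                 (∀ p q → f (p ∨ₙ q) ≈∞ (f p ∨∞ f q)) ×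
                 (∀ p q → f (p ∧ₙ q) ≈∞ (f p ∧∞ f q))

record Theorem3Holds (b : ℕ) (_∨∞_ _∧∞_ : Op₂ (R∞ b)) : Set₁ where
  field
    distributiveLattice :
      IsDistributiveLattice (_≈∞_ {b}) (_≤∞_ {b}) _∨∞_ _∧∞_
    shots-join : ∀ p q (dp : Star (Successor∞ b) [] (proj₁ p))
                       (dq : Star (Successor∞ b) [] (proj₁ q))
                       (dj : Star (Successor∞ b) [] (proj₁ (p ∨∞ q))) i →
                 shots dj i ≡ shots dp i ⊓ shots dq i
    shots-meet : ∀ p q (dp : Star (Successor∞ b) [] (proj₁ p))
                       (dq : Star (Successor∞ b) [] (proj₁ q))
                       (dm : Star (Successor∞ b) [] (proj₁ (p ∧∞ q))) i →
                 shots dm i ≡ shots dp i ⊔ shots dq i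
    π-embedding : ∀ n → Σ (Rb b n → R∞ b) (IsLatticeEmbedding b n _∨∞_ _∧∞_ πList)
    τ-embedding : ∀ n → Σ (Rb b n → R∞ b) (IsLatticeEmbedding b n _∨∞_ _∧∞_ τList)

-- Record a b-ary partition (or an element of R_b(∞)) by its suffix values
-- s_i = Σ_{j ≥ i} p_j b^(j-i).  Firing i raises s_{i+1} by one and leaves the other
-- values unchanged, so along a firing sequence s grows by the shot vector; conversely,
-- a list without trailing zeros whose suffix values dominate those of u (with the same
-- s_0, for R_b(n)) is reached from u by firing greedily from the left.  Hence the order
-- is the reverse componentwise order of suffix values, which determine a list without
-- trailing zeros, and since b s_{i+1} ≤ s_i is preserved by componentwise min and max,
-- join and meet exist and are computed by min and max.  Both embeddings merely shift
-- the suffix values, so they commute with min and max.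
module Submission where

open import Defs
open import Data.Nat using (ℕ; _<_)
open import Data.Product using (Σ)
open import Algebra.Core using (Op₂)

open import Data.Nat using (zero; suc; _+_; _*_; _∸_; _≤_; z≤n; z<s; _⊓_; _⊔_; _≡ᵇ_; NonZero; >-nonZero)
open import Data.Nat.Properties
open import Data.Nat.GeneralisedArithmetic using (iterate)
open import Data.List using (List; []; _∷_; drop; zipWith)
open import Data.List.Relation.Unary.All using (All; []; _∷_)
open import Data.Product using (_×_; _,_; proj₁; proj₂)
open import Data.Unit using (⊤; tt)
open import Data.Bool using (true; false; if_then_else_)
open import Function using (id; _∘_)
open import Relation.Binary.PropositionalEquality
open import Relation.Binary.Construct.Closure.ReflexiveTransitive using (Star; ε; _◅_; _◅◅_; gmap)
open import Relation.Binary.Lattice.Definitions using (Supremum; Infimum)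
open import Relation.Binary.Lattice.Structures using (IsLattice)
open import Relation.Nullary using (contradiction)

open ≡-Reasoning

private
  variable
    k x y : ℕ
    xs ys p q u v w : List ℕ

m∸n+n*suc[o]≡m+n*o : ∀ m n o → n ≤ m → m ∸ n + n * suc o ≡ m + n * o
m∸n+n*suc[o]≡m+n*o m n o n≤m = begin
  m ∸ n + n * suc o   ≡⟨ cong (m ∸ n +_) (*-suc n o) ⟩
  m ∸ n + (n + n * o) ≡⟨ +-assoc (m ∸ n) n (n * o) ⟨
  m ∸ n + n + n * o   ≡⟨ cong (_+ n * o) (m∸n+n≡m n≤m) ⟩
  m + n * o           ∎

m+n*o≡p+n*[q+o]⇒q*n+p≡m : ∀ m n o p q → m + n * o ≡ p + n * (q + o) → q * n + p ≡ m
m+n*o≡p+n*[q+o]⇒q*n+p≡m m n o p q eq = sym (+-cancelʳ-≡ (n * o) m (q * n + p) (begin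
  m + n * o           ≡⟨ eq ⟩
  p + n * (q + o)     ≡⟨ cong (p +_) (*-distribˡ-+ n q o) ⟩
  p + (n * q + n * o) ≡⟨ +-assoc p (n * q) (n * o) ⟨
  p + n * q + n * o   ≡⟨ cong (_+ n * o) (trans (+-comm p (n * q)) (cong (_+ p) (*-comm n q))) ⟩
  q * n + p + n * o   ∎))

infixl 9 _!_
_!_ : List ℕ → ℕ → ℕ
[]       ! i     = 0
(x ∷ xs) ! zero  = x
(x ∷ xs) ! suc i = xs ! i

_⊓ₗ_ : List ℕ → List ℕ → List ℕ
_⊓ₗ_ = zipWith _⊓_

_⊔ₗ_ : List ℕ → List ℕ → List ℕ
[]       ⊔ₗ ys       = ys
(x ∷ xs) ⊔ₗ []       = x ∷ xs
(x ∷ xs) ⊔ₗ (y ∷ ys) = x ⊔ y ∷ xs ⊔ₗ ys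

!-⊓ₗ : ∀ xs ys i → (xs ⊓ₗ ys) ! i ≡ xs ! i ⊓ ys ! i
!-⊓ₗ []       ys       i       = refl
!-⊓ₗ (x ∷ xs) []       i       = sym (⊓-zeroʳ ((x ∷ xs) ! i))
!-⊓ₗ (x ∷ xs) (y ∷ ys) zero    = refl
!-⊓ₗ (x ∷ xs) (y ∷ ys) (suc i) = !-⊓ₗ xs ys i

!-⊔ₗ : ∀ xs ys i → (xs ⊔ₗ ys) ! i ≡ xs ! i ⊔ ys ! i
!-⊔ₗ []       ys       i       = refl
!-⊔ₗ (x ∷ xs) []       i       = sym (⊔-identityʳ ((x ∷ xs) ! i))
!-⊔ₗ (x ∷ xs) (y ∷ ys) zero    = refl
!-⊔ₗ (x ∷ xs) (y ∷ ys) (suc i) = !-⊔ₗ xs ys i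

all-pos-⊓ₗ : All (0 <_) xs → All (0 <_) ys → All (0 <_) (xs ⊓ₗ ys)
all-pos-⊓ₗ []         _          = []
all-pos-⊓ₗ (_ ∷ _)    []         = []
all-pos-⊓ₗ (px ∷ pxs) (py ∷ pys) = ⊓-glb px py ∷ all-pos-⊓ₗ pxs pys

all-pos-⊔ₗ : All (0 <_) xs → All (0 <_) ys → All (0 <_) (xs ⊔ₗ ys)
all-pos-⊔ₗ []                      pys        = pys
all-pos-⊔ₗ (px ∷ pxs)              []         = px ∷ pxs
all-pos-⊔ₗ {x ∷ _} {y ∷ _} (px ∷ pxs) (py ∷ pys) =
  <-≤-trans px (m≤m⊔n x y) ∷ all-pos-⊔ₗ pxs pys

inc : List ℕ → List ℕ
inc []       = 1 ∷ []
inc (x ∷ xs) = suc x ∷ xs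

data NoTrailingZero : List ℕ → Set where
  []  : NoTrailingZero []
  [_] : 0 < x → NoTrailingZero (x ∷ [])
  _∷_ : ∀ x → NoTrailingZero (y ∷ ys) → NoTrailingZero (x ∷ y ∷ ys)

ntz-tail : NoTrailingZero (x ∷ xs) → NoTrailingZero xs
ntz-tail [ _ ]   = []
ntz-tail (_ ∷ n) = n

ntz-drop : NoTrailingZero xs → NoTrailingZero (drop 1 xs)
ntz-drop []      = []
ntz-drop [ _ ]   = []
ntz-drop (_ ∷ n) = n

ntz-inc : NoTrailingZero xs → NoTrailingZero (inc xs)
ntz-inc []      = [ z<s ]
ntz-inc [ _ ]   = [ z<s ]
ntz-inc (_ ∷ n) = _ ∷ n

ntz-iterate-inc : ∀ e → NoTrailingZero xs → NoTrailingZero (iterate inc xs e)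
ntz-iterate-inc zero    n = n
ntz-iterate-inc (suc e) n = ntz-iterate-inc e (ntz-inc n)

module ShotOrder {A : Set} (_⊑_ : A → A → Set) (shot : A → ℕ → ℕ)
  (shot-antitone : ∀ {a c} → a ⊑ c → ∀ i → shot c i ≤ shot a i)
  (⊑-by-shot : ∀ {a c} → (∀ i → shot c i ≤ shot a i) → a ⊑ c) where

  supremum-by-shot : (_∨_ : Op₂ A) → (∀ a c i → shot (a ∨ c) i ≡ shot a i ⊓ shot c i) →
                     Supremum _⊑_ _∨_
  supremum-by-shot _∨_ shot-∨ a c =
      ⊑-by-shot (λ i → ≤-trans (≤-reflexive (shot-∨ a c i)) (m⊓n≤m _ _))
    , ⊑-by-shot (λ i → ≤-trans (≤-reflexive (shot-∨ a c i)) (m⊓n≤n _ _))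
    , λ d a⊑d c⊑d → ⊑-by-shot (λ i → ≤-trans
        (⊓-glb (shot-antitone a⊑d i) (shot-antitone c⊑d i)) (≤-reflexive (sym (shot-∨ a c i))))

  infimum-by-shot : (_∧_ : Op₂ A) → (∀ a c i → shot (a ∧ c) i ≡ shot a i ⊔ shot c i) →
                    Infimum _⊑_ _∧_
  infimum-by-shot _∧_ shot-∧ a c =
      ⊑-by-shot (λ i → ≤-trans (m≤m⊔n _ _) (≤-reflexive (sym (shot-∧ a c i))))
    , ⊑-by-shot (λ i → ≤-trans (m≤n⊔m _ _) (≤-reflexive (sym (shot-∧ a c i))))
    , λ d d⊑a d⊑c → ⊑-by-shot (λ i →
        ≤-trans (≤-reflexive (shot-∧ a c i)) (⊔-lub (shot-antitone d⊑a i) (shot-antitone d⊑c i)))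

  shot-supremum : (_∨_ : Op₂ A) → Supremum _⊑_ _∨_ → ∀ a c r →
                  (∀ i → shot r i ≡ shot a i ⊓ shot c i) →
                  ∀ i → shot (a ∨ c) i ≡ shot a i ⊓ shot c i
  shot-supremum _∨_ sup a c r shot-r i = ≤-antisym
    (⊓-glb (shot-antitone (proj₁ (sup a c)) i) (shot-antitone (proj₁ (proj₂ (sup a c))) i))
    (≤-trans (≤-reflexive (sym (shot-r i))) (shot-antitone (proj₂ (proj₂ (sup a c)) r a⊑r c⊑r) i))
    where
    a⊑r : a ⊑ r
    a⊑r = ⊑-by-shot (λ j → ≤-trans (≤-reflexive (shot-r j)) (m⊓n≤m _ _))
    c⊑r : c ⊑ r
    c⊑r = ⊑-by-shot (λ j → ≤-trans (≤-reflexive (shot-r j)) (m⊓n≤n _ _))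

  shot-infimum : (_∧_ : Op₂ A) → Infimum _⊑_ _∧_ → ∀ a c r →
                 (∀ i → shot r i ≡ shot a i ⊔ shot c i) →
                 ∀ i → shot (a ∧ c) i ≡ shot a i ⊔ shot c i
  shot-infimum _∧_ inf a c r shot-r i = ≤-antisym
    (≤-trans (shot-antitone (proj₂ (proj₂ (inf a c)) r r⊑a r⊑c) i) (≤-reflexive (shot-r i)))
    (⊔-lub (shot-antitone (proj₁ (inf a c)) i) (shot-antitone (proj₁ (proj₂ (inf a c))) i))
    where
    r⊑a : r ⊑ a
    r⊑a = ⊑-by-shot (λ j → ≤-trans (m≤m⊔n _ _) (≤-reflexive (sym (shot-r j))))
    r⊑c : r ⊑ c
    r⊑c = ⊑-by-shot (λ j → ≤-trans (m≤n⊔m _ _) (≤-reflexive (sym (shot-r j))))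

module FiringGame (b : ℕ) .{{_ : NonZero b}} where

  shotVector : List ℕ → List ℕ
  shotVector []       = []
  shotVector (x ∷ xs) = x + b * (shotVector xs ! 0) ∷ shotVector xs

  -- For the finite part p of an element of R_b(∞), shot p i is the number of firings of i.
  -- For a partition p in R_b(n) it is off by one: shot p 0 = n, and shot p (suc i) counts
  -- the firings of i.
  shot : List ℕ → ℕ → ℕ
  shot p i = shotVector p ! i

  _≼_ : List ℕ → List ℕ → Set
  u ≼ v = ∀ i → shot u i ≤ shot v i

  shot-fire : Fire b k u w → ∀ i → shot w i ≡ (if suc k ≡ᵇ i then suc (shot u i) else shot u i)
  shot-fire (fire-mid {x} b≤x) zero          = m∸n+n*suc[o]≡m+n*o x b _ b≤x
  shot-fire (fire-mid _)       (suc zero)    = refl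
  shot-fire (fire-mid _)       (suc (suc i)) = refl
  shot-fire (fire-end {x} b≤x) zero          =
    trans (m∸n+n*suc[o]≡m+n*o x b (b * 0) b≤x) (cong (λ z → x + b * z) (*-zeroʳ b))
  shot-fire (fire-end _)       (suc zero)    = cong suc (*-zeroʳ b)
  shot-fire (fire-end _)       (suc (suc i)) = refl
  shot-fire (fire-tail {y = y} f) zero       = cong (λ z → y + b * z) (shot-fire f 0)
  shot-fire (fire-tail f)      (suc i)       = shot-fire f i

  shot-fire∞ : Fire∞ b k u w → ∀ i → shot w i ≡ (if k ≡ᵇ i then suc (shot u i) else shot u i)
  shot-fire∞ fire0-nil    zero    = cong suc (*-zeroʳ b)
  shot-fire∞ fire0-nil    (suc i) = refl
  shot-fire∞ fire0-cons   zero    = refl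
  shot-fire∞ fire0-cons   (suc i) = refl
  shot-fire∞ (fire-pos f) i       = shot-fire f i

  shot-star∞ : (d : Star (Successor∞ b) u v) → ∀ i → shot v i ≡ shots d i + shot u i
  shot-star∞ ε i = refl
  shot-star∞ ((j , f) ◅ d) i with j ≡ᵇ i | shot-fire∞ f i
  ... | true  | eq = trans (shot-star∞ d i) (trans (cong (shots d i +_) eq) (+-suc _ _))
  ... | false | eq = trans (shot-star∞ d i) (cong (shots d i +_) eq)

  shots≡shot : (d : Star (Successor∞ b) [] v) → ∀ i → shots d i ≡ shot v i
  shots≡shot d i = trans (sym (+-identityʳ _)) (sym (shot-star∞ d i))

  shot-mono∞ : Star (Successor∞ b) u v → u ≼ v
  shot-mono∞ d i = ≤-trans (m≤n+m _ (shots d i)) (≤-reflexive (sym (shot-star∞ d i)))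

  lift∞ : Star (Successor b) u v → Star (Successor∞ b) u v
  lift∞ = gmap id (λ (i , f) → suc i , fire-pos f)

  shot-weight : Star (Successor b) u v → shot v 0 ≡ shot u 0
  shot-weight ε             = refl
  shot-weight ((_ , f) ◅ d) = trans (shot-weight d) (shot-fire f 0)

  shot-drop : ∀ p i → shot (drop 1 p) i ≡ shot p (suc i)
  shot-drop []      i = refl
  shot-drop (_ ∷ _) i = refl

  ntz-fire : Fire b k u w → NoTrailingZero u → NoTrailingZero w
  ntz-fire (fire-mid _)                (_ ∷ n) = _ ∷ ntz-inc n
  ntz-fire (fire-end _)                _       = _ ∷ [ z<s ]
  ntz-fire (fire-tail ())              [ _ ]
  ntz-fire (fire-tail f@(fire-mid _))  (_ ∷ n) = _ ∷ ntz-fire f n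
  ntz-fire (fire-tail f@(fire-end _))  (_ ∷ n) = _ ∷ ntz-fire f n
  ntz-fire (fire-tail f@(fire-tail _)) (_ ∷ n) = _ ∷ ntz-fire f n

  ntz-fire∞ : Fire∞ b k u w → NoTrailingZero u → NoTrailingZero w
  ntz-fire∞ fire0-nil    n = ntz-inc n
  ntz-fire∞ fire0-cons   n = ntz-inc n
  ntz-fire∞ (fire-pos f) n = ntz-fire f n

  ntz-star∞ : Star (Successor∞ b) u v → NoTrailingZero u → NoTrailingZero v
  ntz-star∞ ε             n = n
  ntz-star∞ ((_ , f) ◅ d) n = ntz-star∞ d (ntz-fire∞ f n)

  shot-pos : NoTrailingZero (x ∷ xs) → 0 < shot (x ∷ xs) 0
  shot-pos {x} [ x>0 ] = <-≤-trans x>0 (m≤m+n x _)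
  shot-pos {x} (_ ∷ n) = <-≤-trans (shot-pos n) (≤-trans (m≤n*m _ b) (m≤n+m _ x))

  shot-injective : NoTrailingZero u → NoTrailingZero v → (∀ i → shot u i ≡ shot v i) → u ≡ v
  shot-injective {[]}     {[]}     _  _  _  = refl
  shot-injective {[]}     {_ ∷ _}  _  nv eq = contradiction (eq 0) (<⇒≢ (shot-pos nv))
  shot-injective {_ ∷ _}  {[]}     nu _  eq = contradiction (sym (eq 0)) (<⇒≢ (shot-pos nu))
  shot-injective {x ∷ xs} {y ∷ ys} nu nv eq = cong₂ _∷_ x≡y xs≡ys
    where
    xs≡ys : xs ≡ ys
    xs≡ys = shot-injective (ntz-tail nu) (ntz-tail nv) (eq ∘ suc)
    x≡y : x ≡ y
    x≡y = +-cancelʳ-≡ (b * shot xs 0) x y (trans (eq 0) (cong (λ zs → y + b * shot zs 0) (sym xs≡ys)))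

  fire-head : b ≤ x → Fire b 0 (x ∷ u) (x ∸ b ∷ inc u)
  fire-head {u = []}    b≤x = fire-end b≤x
  fire-head {u = _ ∷ _} b≤x = fire-mid b≤x

  fire-head-repeatedly : ∀ e x u → Star (Successor b) (e * b + x ∷ u) (x ∷ iterate inc u e)
  fire-head-repeatedly zero    x u = ε
  fire-head-repeatedly (suc e) x u = (0 , fire-once) ◅ fire-head-repeatedly e x (inc u)
    where
    fire-once : Fire b 0 (b + e * b + x ∷ u) (e * b + x ∷ inc u)
    fire-once = subst (λ z → Fire b 0 (b + e * b + x ∷ u) (z ∷ inc u))
      (trans (cong (_∸ b) (+-assoc b (e * b) x)) (m+n∸m≡n b (e * b + x)))
      (fire-head (≤-trans (m≤m+n b (e * b)) (m≤m+n _ x)))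

  fire∞-head : ∀ u → Fire∞ b 0 u (inc u)
  fire∞-head []      = fire0-nil
  fire∞-head (_ ∷ _) = fire0-cons

  fire∞-head-repeatedly : ∀ e u → Star (Successor∞ b) u (iterate inc u e)
  fire∞-head-repeatedly zero    u = ε
  fire∞-head-repeatedly (suc e) u = (0 , fire∞-head u) ◅ fire∞-head-repeatedly e (inc u)

  shot-iterate-inc-zero : ∀ e u → shot (iterate inc u e) 0 ≡ e + shot u 0
  shot-iterate-inc-zero zero    u = refl
  shot-iterate-inc-zero (suc e) u = begin
    shot (iterate inc (inc u) e) 0 ≡⟨ shot-iterate-inc-zero e (inc u) ⟩
    e + shot (inc u) 0             ≡⟨ cong (e +_) (shot-fire∞ (fire∞-head u) 0) ⟩
    e + suc (shot u 0)             ≡⟨ +-suc e _ ⟩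
    suc e + shot u 0               ∎

  shot-iterate-inc-suc : ∀ e u i → shot (iterate inc u e) (suc i) ≡ shot u (suc i)
  shot-iterate-inc-suc zero    u i = refl
  shot-iterate-inc-suc (suc e) u i =
    trans (shot-iterate-inc-suc e (inc u) i) (shot-fire∞ (fire∞-head u) (suc i))

  raiseTo : List ℕ → List ℕ → List ℕ
  raiseTo v u = iterate inc u (shot v 0 ∸ shot u 0)

  shot-raiseTo : shot u 0 ≤ shot v 0 → shot (raiseTo v u) 0 ≡ shot v 0
  shot-raiseTo {u} {v} u₀≤v₀ = trans (shot-iterate-inc-zero _ u) (m∸n+n≡m u₀≤v₀)

  raiseTo-≼ : u ≼ v → raiseTo v u ≼ v
  raiseTo-≼ {u} {v} u≼v zero    = ≤-reflexive (shot-raiseTo {u} {v} (u≼v 0))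
  raiseTo-≼ {u} {v} u≼v (suc i) =
    ≤-trans (≤-reflexive (shot-iterate-inc-suc (shot v 0 ∸ shot u 0) u i)) (u≼v (suc i))

  reach : NoTrailingZero u → NoTrailingZero v → shot u 0 ≡ shot v 0 → u ≼ v → Star (Successor b) u v
  reach {[]}     {[]}     _  _  _  _   = ε
  reach {[]}     {_ ∷ _}  _  nv eq _   = contradiction eq (<⇒≢ (shot-pos nv))
  reach {_ ∷ _}  {[]}     nu _  eq _   = contradiction (sym eq) (<⇒≢ (shot-pos nu))
  reach {x ∷ xs} {y ∷ ys} nu nv eq u≼v =
    subst (λ z → Star (Successor b) (z ∷ xs) (y ∷ raiseTo ys xs)) head-eq (fire-head-repeatedly e y xs)
    ◅◅ gmap (y ∷_) (λ (i , f) → suc i , fire-tail f)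
         (reach (ntz-iterate-inc e (ntz-tail nu)) (ntz-tail nv)
                (shot-raiseTo {xs} {ys} (u≼v 1)) (raiseTo-≼ {xs} {ys} (u≼v ∘ suc)))
    where
    e : ℕ
    e = shot ys 0 ∸ shot xs 0
    head-eq : e * b + y ≡ x
    head-eq = m+n*o≡p+n*[q+o]⇒q*n+p≡m x b (shot xs 0) y e
      (trans eq (cong (λ c → y + b * c) (sym (m∸n+n≡m (u≼v 1)))))

  reach∞ : NoTrailingZero u → NoTrailingZero v → u ≼ v → Star (Successor∞ b) u v
  reach∞ {u} {v} nu nv u≼v = fire∞-head-repeatedly e u
    ◅◅ lift∞ (reach (ntz-iterate-inc e nu) nv (shot-raiseTo {u} {v} (u≼v 0)) (raiseTo-≼ {u} {v} u≼v))
    where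
    e : ℕ
    e = shot v 0 ∸ shot u 0

  IsShotVector : List ℕ → Set
  IsShotVector []       = ⊤
  IsShotVector (x ∷ xs) = b * (xs ! 0) ≤ x × IsShotVector xs

  fromShotVector : List ℕ → List ℕ
  fromShotVector []       = []
  fromShotVector (x ∷ xs) = x ∸ b * (xs ! 0) ∷ fromShotVector xs

  shotVector-isShotVector : ∀ p → IsShotVector (shotVector p)
  shotVector-isShotVector []       = tt
  shotVector-isShotVector (x ∷ xs) = m≤n+m _ x , shotVector-isShotVector xs

  shotVector-fromShotVector : ∀ t → IsShotVector t → shotVector (fromShotVector t) ≡ t
  shotVector-fromShotVector []       _          = refl
  shotVector-fromShotVector (x ∷ xs) (bx≤x , t)
    rewrite shotVector-fromShotVector xs t = cong (_∷ xs) (m∸n+n≡m bx≤x)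

  isShotVector-⊓ₗ : ∀ s t → IsShotVector s → IsShotVector t → IsShotVector (s ⊓ₗ t)
  isShotVector-⊓ₗ []       _        _          _          = tt
  isShotVector-⊓ₗ (_ ∷ _)  []       _          _          = tt
  isShotVector-⊓ₗ (x ∷ xs) (y ∷ ys) (hx , vxs) (hy , vys) =
    ≤-trans (≤-reflexive (trans (cong (b *_) (!-⊓ₗ xs ys 0)) (*-distribˡ-⊓ b _ _))) (⊓-mono-≤ hx hy)
    , isShotVector-⊓ₗ xs ys vxs vys

  isShotVector-⊔ₗ : ∀ s t → IsShotVector s → IsShotVector t → IsShotVector (s ⊔ₗ t)
  isShotVector-⊔ₗ []       _        _          vt         = vt
  isShotVector-⊔ₗ (_ ∷ _)  []       vs         _          = vs
  isShotVector-⊔ₗ (x ∷ xs) (y ∷ ys) (hx , vxs) (hy , vys) =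
    ≤-trans (≤-reflexive (trans (cong (b *_) (!-⊔ₗ xs ys 0)) (*-distribˡ-⊔ b _ _))) (⊔-mono-≤ hx hy)
    , isShotVector-⊔ₗ xs ys vxs vys

  shotVector-pos : NoTrailingZero p → All (0 <_) (shotVector p)
  shotVector-pos []        = []
  shotVector-pos n@([ _ ]) = shot-pos n ∷ []
  shotVector-pos n@(_ ∷ m) = shot-pos n ∷ shotVector-pos m

  ntz-fromShotVector : ∀ t → All (0 <_) t → NoTrailingZero (fromShotVector t)
  ntz-fromShotVector []           []         = []
  ntz-fromShotVector (x ∷ [])     (x>0 ∷ []) = [ subst (0 <_) (cong (x ∸_) (sym (*-zeroʳ b))) x>0 ]
  ntz-fromShotVector (_ ∷ y ∷ ys) (_ ∷ pos)  = _ ∷ ntz-fromShotVector (y ∷ ys) pos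

  infixl 6 _∨ₗ_
  infixl 7 _∧ₗ_

  _∨ₗ_ : List ℕ → List ℕ → List ℕ
  p ∨ₗ q = fromShotVector (shotVector p ⊓ₗ shotVector q)

  _∧ₗ_ : List ℕ → List ℕ → List ℕ
  p ∧ₗ q = fromShotVector (shotVector p ⊔ₗ shotVector q)

  shot-∨ₗ : ∀ p q i → shot (p ∨ₗ q) i ≡ shot p i ⊓ shot q i
  shot-∨ₗ p q i
    rewrite shotVector-fromShotVector _ (isShotVector-⊓ₗ (shotVector p) (shotVector q)
                                           (shotVector-isShotVector p) (shotVector-isShotVector q))
    = !-⊓ₗ (shotVector p) (shotVector q) i

  shot-∧ₗ : ∀ p q i → shot (p ∧ₗ q) i ≡ shot p i ⊔ shot q i
  shot-∧ₗ p q i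
    rewrite shotVector-fromShotVector _ (isShotVector-⊔ₗ (shotVector p) (shotVector q)
                                           (shotVector-isShotVector p) (shotVector-isShotVector q))
    = !-⊔ₗ (shotVector p) (shotVector q) i

  ntz-∨ₗ : NoTrailingZero p → NoTrailingZero q → NoTrailingZero (p ∨ₗ q)
  ntz-∨ₗ np nq = ntz-fromShotVector _ (all-pos-⊓ₗ (shotVector-pos np) (shotVector-pos nq))

  ntz-∧ₗ : NoTrailingZero p → NoTrailingZero q → NoTrailingZero (p ∧ₗ q)
  ntz-∧ₗ np nq = ntz-fromShotVector _ (all-pos-⊔ₗ (shotVector-pos np) (shotVector-pos nq))

  ntz∞ : (p : R∞ b) → NoTrailingZero (proj₁ p)
  ntz∞ (_ , d) = ntz-star∞ d []

  element∞ : NoTrailingZero p → R∞ b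
  element∞ {p} n = p , reach∞ [] n (λ _ → z≤n)

  _∨∞_ : Op₂ (R∞ b)
  p ∨∞ q = element∞ (ntz-∨ₗ (ntz∞ p) (ntz∞ q))

  _∧∞_ : Op₂ (R∞ b)
  p ∧∞ q = element∞ (ntz-∧ₗ (ntz∞ p) (ntz∞ q))

  ≈∞-by-shot : (p q : R∞ b) → (∀ i → shot (proj₁ p) i ≡ shot (proj₁ q) i) → p ≈∞ q
  ≈∞-by-shot p q = shot-injective (ntz∞ p) (ntz∞ q)

  open ShotOrder (_≤∞_ {b}) (shot ∘ proj₁) shot-mono∞ (λ {p} {q} → reach∞ (ntz∞ q) (ntz∞ p))
    using (supremum-by-shot; infimum-by-shot)

  isLattice∞ : IsLattice _≈∞_ _≤∞_ _∨∞_ _∧∞_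
  isLattice∞ = record
    { isPartialOrder = record
      { isPreorder = record
        { isEquivalence = record { refl = refl ; sym = sym ; trans = trans }
        ; reflexive     = λ {p} {q} p≈q → subst (Star (Successor∞ b) (proj₁ q)) (sym p≈q) ε
        ; trans         = λ p≤q q≤r → q≤r ◅◅ p≤q
        }
      ; antisym = λ {p} {q} p≤q q≤p →
          ≈∞-by-shot p q (λ i → ≤-antisym (shot-mono∞ q≤p i) (shot-mono∞ p≤q i))
      }
    ; supremum = supremum-by-shot _∨∞_ (λ p q → shot-∨ₗ (proj₁ p) (proj₁ q))
    ; infimum  = infimum-by-shot _∧∞_ (λ p q → shot-∧ₗ (proj₁ p) (proj₁ q))
    }

  shot-∧ₗ-distribˡ-∨ₗ : ∀ p q r i → shot (p ∧ₗ (q ∨ₗ r)) i ≡ shot (p ∧ₗ q ∨ₗ p ∧ₗ r) i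
  shot-∧ₗ-distribˡ-∨ₗ p q r i = begin
    shot (p ∧ₗ (q ∨ₗ r)) i                        ≡⟨ shot-∧ₗ p (q ∨ₗ r) i ⟩
    shot p i ⊔ shot (q ∨ₗ r) i                    ≡⟨ cong (shot p i ⊔_) (shot-∨ₗ q r i) ⟩
    shot p i ⊔ (shot q i ⊓ shot r i)              ≡⟨ ⊔-distribˡ-⊓ (shot p i) (shot q i) (shot r i) ⟩
    (shot p i ⊔ shot q i) ⊓ (shot p i ⊔ shot r i) ≡⟨ cong₂ _⊓_ (shot-∧ₗ p q i) (shot-∧ₗ p r i) ⟨
    shot (p ∧ₗ q) i ⊓ shot (p ∧ₗ r) i             ≡⟨ shot-∨ₗ (p ∧ₗ q) (p ∧ₗ r) i ⟨
    shot (p ∧ₗ q ∨ₗ p ∧ₗ r) i                     ∎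

  ∧∞-distribˡ-∨∞ : ∀ x y z → (x ∧∞ (y ∨∞ z)) ≈∞ ((x ∧∞ y) ∨∞ (x ∧∞ z))
  ∧∞-distribˡ-∨∞ x y z = ≈∞-by-shot (x ∧∞ (y ∨∞ z)) ((x ∧∞ y) ∨∞ (x ∧∞ z))
    (shot-∧ₗ-distribˡ-∨ₗ (proj₁ x) (proj₁ y) (proj₁ z))

  shots-∨∞ : ∀ p q (dp : Star (Successor∞ b) [] (proj₁ p)) (dq : Star (Successor∞ b) [] (proj₁ q))
             (dj : Star (Successor∞ b) [] (proj₁ (p ∨∞ q))) i → shots dj i ≡ shots dp i ⊓ shots dq i
  shots-∨∞ (p , _) (q , _) dp dq dj i = begin
    shots dj i              ≡⟨ shots≡shot dj i ⟩
    shot (p ∨ₗ q) i         ≡⟨ shot-∨ₗ p q i ⟩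
    shot p i ⊓ shot q i     ≡⟨ cong₂ _⊓_ (shots≡shot dp i) (shots≡shot dq i) ⟨
    shots dp i ⊓ shots dq i ∎

  shots-∧∞ : ∀ p q (dp : Star (Successor∞ b) [] (proj₁ p)) (dq : Star (Successor∞ b) [] (proj₁ q))
             (dm : Star (Successor∞ b) [] (proj₁ (p ∧∞ q))) i → shots dm i ≡ shots dp i ⊔ shots dq i
  shots-∧∞ (p , _) (q , _) dp dq dm i = begin
    shots dm i              ≡⟨ shots≡shot dm i ⟩
    shot (p ∧ₗ q) i         ≡⟨ shot-∧ₗ p q i ⟩
    shot p i ⊔ shot q i     ≡⟨ cong₂ _⊔_ (shots≡shot dp i) (shots≡shot dq i) ⟨
    shots dp i ⊔ shots dq i ∎

  shot-start : ∀ n → shot (start n) 0 ≡ n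
  shot-start zero    = refl
  shot-start (suc n) = cong suc (trans (cong (n +_) (*-zeroʳ b)) (+-identityʳ n))

  ntz-start : ∀ n → NoTrailingZero (start n)
  ntz-start zero    = []
  ntz-start (suc n) = [ z<s ]

  start-≼ : ∀ n → n ≤ shot p 0 → start n ≼ p
  start-≼ zero    _   _       = z≤n
  start-≼ (suc n) n≤p zero    = ≤-trans (≤-reflexive (shot-start (suc n))) n≤p
  start-≼ (suc n) _   (suc i) = z≤n

  module Partitions (n : ℕ) where

    ntzₙ : (p : Rb b n) → NoTrailingZero (proj₁ p)
    ntzₙ (_ , d) = ntz-star∞ (lift∞ d) (ntz-start n)

    shot-weightₙ : (p : Rb b n) → shot (proj₁ p) 0 ≡ n
    shot-weightₙ (_ , d) = trans (shot-weight d) (shot-start n)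

    elementₙ : NoTrailingZero p → shot p 0 ≡ n → Rb b n
    elementₙ {p} np p₀≡n =
      p , reach (ntz-start n) np (trans (shot-start n) (sym p₀≡n))
                (start-≼ {p} n (≤-reflexive (sym p₀≡n)))

    ≼⇒≤ₙ : (p q : Rb b n) → proj₁ q ≼ proj₁ p → p ≤ₙ q
    ≼⇒≤ₙ p q = reach (ntzₙ q) (ntzₙ p) (trans (shot-weightₙ q) (sym (shot-weightₙ p)))

    open ShotOrder (_≤ₙ_ {b} {n}) (shot ∘ proj₁) (shot-mono∞ ∘ lift∞) (λ {p} {q} → ≼⇒≤ₙ p q)
      using (shot-supremum; shot-infimum)

    -- R_b(n) carries at most one lattice structure, and its operations are ∨ₗ and ∧ₗ.
    module _ {_∨ₙ_ _∧ₙ_ : Op₂ (Rb b n)} (lattice : IsLattice _≈ₙ_ _≤ₙ_ _∨ₙ_ _∧ₙ_) where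
      open IsLattice lattice using (supremum; infimum)

      ∨ₙ-underlying : ∀ p q → proj₁ (p ∨ₙ q) ≡ proj₁ p ∨ₗ proj₁ q
      ∨ₙ-underlying p@(P , _) q@(Q , _) =
        shot-injective (ntzₙ (p ∨ₙ q)) (ntz-∨ₗ (ntzₙ p) (ntzₙ q)) λ i →
          trans (shot-supremum _∨ₙ_ supremum p q r (shot-∨ₗ P Q) i) (sym (shot-∨ₗ P Q i))
        where
        r : Rb b n
        r = elementₙ (ntz-∨ₗ (ntzₙ p) (ntzₙ q))
              (trans (shot-∨ₗ P Q 0)
                     (trans (cong₂ _⊓_ (shot-weightₙ p) (shot-weightₙ q)) (⊓-idem n)))

      ∧ₙ-underlying : ∀ p q → proj₁ (p ∧ₙ q) ≡ proj₁ p ∧ₗ proj₁ q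
      ∧ₙ-underlying p@(P , _) q@(Q , _) =
        shot-injective (ntzₙ (p ∧ₙ q)) (ntz-∧ₗ (ntzₙ p) (ntzₙ q)) λ i →
          trans (shot-infimum _∧ₙ_ infimum p q r (shot-∧ₗ P Q) i) (sym (shot-∧ₗ P Q i))
        where
        r : Rb b n
        r = elementₙ (ntz-∧ₗ (ntzₙ p) (ntzₙ q))
              (trans (shot-∧ₗ P Q 0)
                     (trans (cong₂ _⊔_ (shot-weightₙ p) (shot-weightₙ q)) (⊔-idem n)))

    latticeEmbedding : (g : List ℕ → List ℕ) (k : ℕ) →
                       (∀ {p} → NoTrailingZero p → NoTrailingZero (g p)) →
                       (∀ p i → shot (g p) i ≡ shot p (k + i)) →
                       (∀ p q → g (proj₁ p) ≡ g (proj₁ q) → p ≈ₙ q) →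
                       Σ (Rb b n → R∞ b) (IsLatticeEmbedding b n _∨∞_ _∧∞_ g)
    latticeEmbedding g k ntz-g shot-g g-injective = f , record
      { underlying = λ _ → refl
      ; injective  = g-injective
      ; hom        = λ _ _ lattice →
            (λ p q → trans (cong g (∨ₙ-underlying lattice p q)) (g-∨ₗ (ntzₙ p) (ntzₙ q)))
          , (λ p q → trans (cong g (∧ₙ-underlying lattice p q)) (g-∧ₗ (ntzₙ p) (ntzₙ q)))
      }
      where
      f : Rb b n → R∞ b
      f p = element∞ (ntz-g (ntzₙ p))

      g-∨ₗ : NoTrailingZero p → NoTrailingZero q → g (p ∨ₗ q) ≡ g p ∨ₗ g q
      g-∨ₗ {p} {q} np nq =
        shot-injective (ntz-g (ntz-∨ₗ np nq)) (ntz-∨ₗ (ntz-g np) (ntz-g nq)) λ i → begin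
        shot (g (p ∨ₗ q)) i             ≡⟨ shot-g (p ∨ₗ q) i ⟩
        shot (p ∨ₗ q) (k + i)           ≡⟨ shot-∨ₗ p q (k + i) ⟩
        shot p (k + i) ⊓ shot q (k + i) ≡⟨ cong₂ _⊓_ (shot-g p i) (shot-g q i) ⟨
        shot (g p) i ⊓ shot (g q) i     ≡⟨ shot-∨ₗ (g p) (g q) i ⟨
        shot (g p ∨ₗ g q) i             ∎

      g-∧ₗ : NoTrailingZero p → NoTrailingZero q → g (p ∧ₗ q) ≡ g p ∧ₗ g q
      g-∧ₗ {p} {q} np nq =
        shot-injective (ntz-g (ntz-∧ₗ np nq)) (ntz-∧ₗ (ntz-g np) (ntz-g nq)) λ i → begin
        shot (g (p ∧ₗ q)) i             ≡⟨ shot-g (p ∧ₗ q) i ⟩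
        shot (p ∧ₗ q) (k + i)           ≡⟨ shot-∧ₗ p q (k + i) ⟩
        shot p (k + i) ⊔ shot q (k + i) ≡⟨ cong₂ _⊔_ (shot-g p i) (shot-g q i) ⟨
        shot (g p) i ⊔ shot (g q) i     ≡⟨ shot-∧ₗ (g p) (g q) i ⟨
        shot (g p ∧ₗ g q) i             ∎

    π-injective : ∀ p q → πList (proj₁ p) ≡ πList (proj₁ q) → p ≈ₙ q
    π-injective p@(P , _) q@(Q , _) eq = shot-injective (ntzₙ p) (ntzₙ q) λ
      { zero    → trans (shot-weightₙ p) (sym (shot-weightₙ q))
      ; (suc i) → trans (sym (shot-drop P i)) (trans (cong (λ r → shot r i) eq) (shot-drop Q i))
      }

  open Partitions using (latticeEmbedding; π-injective)

  theorem3-holds : Theorem3Holds b _∨∞_ _∧∞_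
  theorem3-holds = record
    { distributiveLattice = record { isLattice = isLattice∞ ; ∧-distribˡ-∨ = ∧∞-distribˡ-∨∞ }
    ; shots-join          = shots-∨∞
    ; shots-meet          = shots-∧∞
    ; π-embedding         = λ n → latticeEmbedding n πList 1 ntz-drop shot-drop (π-injective n)
    ; τ-embedding         = λ n → latticeEmbedding n τList 0 id (λ _ _ → refl) (λ _ _ → id)
    }

theorem3 : (b : ℕ) → 1 < b →
    Σ (Op₂ (R∞ b)) λ _∨_ → Σ (Op₂ (R∞ b)) λ _∧_ → Theorem3Holds b _∨_ _∧_
theorem3 b 1<b = _∨∞_ , _∧∞_ , theorem3-holds
  where
  instance
    b≢0 : NonZero b
    b≢0 = >-nonZero (m<n⇒0<n 1<b)
  open FiringGame b
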